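{- For every $\delta>0$ and $n\in\mathbb{N}$ there exists $N\in\mathbb{N}$ such that the following holds for every $N$-partitioned hypergraph $H$ and every choice of subsets $W_{jij'kj''}\subseteq V_{ik}$, for all $i,k,j,j',j''\in[N]$ with $j<i<j'<k<j''$, satisfying $|W_{jij'kj''}|\ge\delta|V_{ik}|$. There exist an induced $n$-partitioned subhypergraph of $H$ with index set $I\subseteq[N]$ and vertices $w_{ik}\in V_{ik}$, $i<k$, $i,k\in I$, such that $w_{ik}\in W_{jij'kj''}$ for all $j,j',j''\in I$ with $j<i<j'<k<j''$.
   Context: An $N$-partitioned hypergraph $H$ is a $3$-uniform hypergraph whose vertex set is partitioned into nonempty finite sets $V_{ij}$, $1\le i<j\le N$, such that every edge has one vertex in each of $V_{ij},V_{ik},V_{jk}$ for some $1\le i<j<k\le N$. For $I\subseteq[N]$, the (induced) subhypergraph induced by $I$ is the $|I|$-partitioned hypergraph with parts $V_{ij}$, $i<j$, $i,j\in I$ (keeping original indices) and all edges of $H$ contained in the union of these parts; $I$ is called its index set.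
   Formalization: The parameter δ ranges over the positive rationals. -}

module Defs where

open import Data.Nat using (ℕ; _≥_)
open import Data.Fin using (Fin; _<_)
open import Data.Fin.Subset using (Subset; _∈_; ∣_∣)
open import Data.Rational using (ℚ; _≤_; _*_; _/_; Positive)
open import Level using (0ℓ) renaming (suc to lsuc)

-- For i < j the part V_ij is Fin (size i j), required
-- nonempty; the values of size i j for i ≥ j are irrelevant (unused).
record PartHyp (N : ℕ) : Set₁ where
  field
    size     : Fin N → Fin N → ℕ
    nonempty : ∀ i j → i < j → size i j ≥ 1
    edge     : (i j k : Fin N) → i < j → j < k →
               Fin (size i j) → Fin (size i k) → Fin (size j k) → Set

open PartHyp public

V : ∀ {N} → PartHyp N → Fin N → Fin N → Set
V H i j = Fin (size H i j)

-- An index set I ⊆ [N] of size n, listed increasingly: a strictly increasing map.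
StrictlyIncreasing : ∀ {n N} → (Fin n → Fin N) → Set
StrictlyIncreasing {n} f = ∀ (a b : Fin n) → a < b → f a < f b

toℚ : ℕ → ℚ
toℚ m = Data.Integer.+ m / 1
  where import Data.Integer

{-# OPTIONS --safe #-}
-- Colour the n-subsets x₁ < … < xₙ of the index set by whether, for a fixed pair a < b, some vertex
-- of V_{xₐ x_b} lies in every W_{x_c xₐ x_d x_b x_e} with c < a < d < b < e. Ramsey's theorem,
-- applied simultaneously to these n² colourings, gives a large index set on which every colouring
-- is constant, so it suffices that every large set contains one good n-subset for each pair.
-- To find one, split the large set into blocks C < α < D < β < E: by averaging, some w ∈ V_αβ lies
-- in a δ fraction of the sets W_cαdβe, and two rounds of Markov's inequality, each followed by
-- pigeonholing on incidence patterns, give n indices in each of C, D and E with w in every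
-- corresponding W.

module Submission where

open import Defs
open import Data.Bool.Base using (Bool; true; false; not; T)
open import Data.Empty using (⊥-elim)
open import Data.Fin.Base using (Fin; zero; suc; toℕ; _<_; _↑ˡ_; _↑ʳ_; combine; remQuot)
open import Data.Fin.Properties
  using (<-trans; <-asym; <-irrefl; <-cmp; toℕ<n; toℕ-↑ˡ; toℕ-↑ʳ; remQuot-combine; any?; all?; _<?_)
open import Data.Fin.Subset using (Subset; _∈_; ∣_∣)
open import Data.Fin.Subset.Properties using (_∈?_)
open import Data.Nat.Base as ℕ using (ℕ; zero; suc; _+_; z≤n; s≤s; NonZero)
import Data.Nat.Properties as ℕ
open import Data.Product.Base using (Σ; ∃; _×_; _,_; proj₁; proj₂; uncurry)
open import Data.Sum.Base using (_⊎_; inj₁; inj₂)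
open import Data.Vec.Base using ([]; _∷_; lookup)
open import Function.Base using (_∘_)
open import Relation.Binary.Definitions using (tri<; tri≈; tri>)
open import Relation.Binary.PropositionalEquality
open import Relation.Nullary.Decidable using (Dec; does; yes; no; ⌊_⌋; toWitness; _→-dec_; dec-true; isYes≗does)
open import Relation.Nullary.Negation using (contradiction)

variable
  k l m n : ℕ

-- m ⊑ n: an m-element subset of Fin n, as an order-preserving injection.
infix  4 _⊑_
infixr 9 _∘⊑_

data _⊑_ : ℕ → ℕ → Set where
  done : 0 ⊑ 0
  keep : m ⊑ n → suc m ⊑ suc n
  drop : m ⊑ n → m ⊑ suc n

_∘⊑_ : k ⊑ m → m ⊑ n → k ⊑ n
g      ∘⊑ done   = g
g      ∘⊑ drop f = drop (g ∘⊑ f)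
keep g ∘⊑ keep f = keep (g ∘⊑ f)
drop g ∘⊑ keep f = drop (g ∘⊑ f)

∘⊑-assoc : ∀ {j} (h : j ⊑ k) (g : k ⊑ m) (f : m ⊑ n) → (h ∘⊑ g) ∘⊑ f ≡ h ∘⊑ (g ∘⊑ f)
∘⊑-assoc h        g        done     = refl
∘⊑-assoc h        g        (drop f) = cong drop (∘⊑-assoc h g f)
∘⊑-assoc (keep h) (keep g) (keep f) = cong keep (∘⊑-assoc h g f)
∘⊑-assoc (drop h) (keep g) (keep f) = cong drop (∘⊑-assoc h g f)
∘⊑-assoc h        (drop g) (keep f) = cong drop (∘⊑-assoc h g f)

0⊑ : ∀ n → 0 ⊑ n
0⊑ zero    = done
0⊑ (suc n) = drop (0⊑ n)

0⊑-unique : (f : 0 ⊑ n) → f ≡ 0⊑ n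
0⊑-unique done     = refl
0⊑-unique (drop f) = cong drop (0⊑-unique f)

≤⇒⊑ : m ℕ.≤ n → m ⊑ n
≤⇒⊑ {n = n} z≤n = 0⊑ n
≤⇒⊑ (s≤s m≤n)   = keep (≤⇒⊑ m≤n)

embed : m ⊑ n → Fin m → Fin n
embed (keep f) zero    = zero
embed (keep f) (suc i) = suc (embed f i)
embed (drop f) i       = suc (embed f i)

embed-∘⊑ : (g : k ⊑ m) (f : m ⊑ n) (i : Fin k) → embed (g ∘⊑ f) i ≡ embed f (embed g i)
embed-∘⊑ done     done     ()
embed-∘⊑ g        (drop f) i       = cong suc (embed-∘⊑ g f i)
embed-∘⊑ (keep g) (keep f) zero    = refl
embed-∘⊑ (keep g) (keep f) (suc i) = cong suc (embed-∘⊑ g f i)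
embed-∘⊑ (drop g) (keep f) i       = cong suc (embed-∘⊑ g f i)

embed-increasing : (f : m ⊑ n) → StrictlyIncreasing (embed f)
embed-increasing (keep f) zero    (suc j) _         = s≤s z≤n
embed-increasing (keep f) (suc i) (suc j) (s≤s i<j) = s≤s (embed-increasing f i j i<j)
embed-increasing (drop f) i       j       i<j       = s≤s (embed-increasing f i j i<j)

increasing⇒⊑ : (h : Fin m → Fin n) → StrictlyIncreasing h → Σ (m ⊑ n) λ f → ∀ i → embed f i ≡ h i

private
  pred : (x : Fin (suc n)) → zero {n} < x → Fin n
  pred (suc x) _ = x

  suc-pred : (x : Fin (suc n)) (0<x : zero {n} < x) → suc (pred x 0<x) ≡ x
  suc-pred (suc x) _ = refl

  pred-mono : (x y : Fin (suc n)) (0<x : zero {n} < x) (0<y : zero {n} < y) →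
              x < y → pred x 0<x < pred y 0<y
  pred-mono (suc x) (suc y) _ _ (s≤s x<y) = x<y

  positive-increasing⇒⊑ : (h : Fin m → Fin (suc n)) → (∀ i → zero {n} < h i) → StrictlyIncreasing h →
                          Σ (m ⊑ n) λ f → ∀ i → suc (embed f i) ≡ h i
  positive-increasing⇒⊑ h 0<h inc = proj₁ lowered , λ i → trans (cong suc (proj₂ lowered i)) (suc-pred (h i) (0<h i))
    where
    lowered = increasing⇒⊑ (λ i → pred (h i) (0<h i)) (λ i j i<j → pred-mono _ _ (0<h i) (0<h j) (inc i j i<j))

increasing⇒⊑ {zero}  {n}     h inc = 0⊑ n , λ ()
increasing⇒⊑ {suc m} {zero}  h inc with () ← h zero
increasing⇒⊑ {suc m} {suc n} h inc with h zero in h₀≡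
... | zero  = keep (proj₁ tail) , λ where
    zero    → sym h₀≡
    (suc i) → proj₂ tail i
  where
  tail = positive-increasing⇒⊑ (h ∘ suc) (λ i → subst (_< h (suc i)) h₀≡ (inc zero (suc i) (s≤s z≤n)))
                               (λ i j i<j → inc (suc i) (suc j) (s≤s i<j))
... | suc _ = drop (proj₁ lowered) , proj₂ lowered
  where
  0<h : ∀ i → zero {n} < h i
  0<h zero    = subst (zero {n} <_) (sym h₀≡) (s≤s z≤n)
  0<h (suc i) = <-trans (0<h zero) (inc zero (suc i) (s≤s z≤n))
  lowered = positive-increasing⇒⊑ h 0<h inc

Homogeneous : (k ⊑ n → Bool) → m ⊑ n → Bool → Set
Homogeneous {k} {m = m} colour f c = (g : k ⊑ m) → colour (g ∘⊑ f) ≡ c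

homogeneous-∘⊑ : (colour : k ⊑ n → Bool) {c : Bool} (f : m ⊑ n) {g : l ⊑ m} →
                 Homogeneous (λ h → colour (h ∘⊑ f)) g c → Homogeneous colour (g ∘⊑ f) c
homogeneous-∘⊑ colour f {g} hom h = trans (cong colour (sym (∘⊑-assoc h g f))) (hom h)

homogeneous-agree : (colour : k ⊑ n → Bool) {f : m ⊑ n} {c : Bool} →
                    Homogeneous colour f c → (g g′ : k ⊑ m) → colour (g ∘⊑ f) ≡ colour (g′ ∘⊑ f)
homogeneous-agree colour hom g g′ = trans (hom g) (sym (hom g′))

ramseyBound : ℕ → ℕ → ℕ → ℕ
ramseyBound zero    a       b       = a + b
ramseyBound (suc k) zero    b       = 0
ramseyBound (suc k) (suc a) zero    = 0
ramseyBound (suc k) (suc a) (suc b) =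
  suc (ramseyBound k (ramseyBound (suc k) a (suc b)) (ramseyBound (suc k) (suc a) b))

Ramsey : ℕ → ℕ → ℕ → Set
Ramsey k a b = (colour : k ⊑ ramseyBound k a b → Bool) →
  (Σ (a ⊑ ramseyBound k a b) λ f → Homogeneous colour f true) ⊎
  (Σ (b ⊑ ramseyBound k a b) λ f → Homogeneous colour f false)

module _ {R : ℕ} (colour : suc k ⊑ suc R → Bool) {c : Bool} where

  homogeneous-keep : (f : m ⊑ R) {g : l ⊑ m} → Homogeneous (colour ∘ keep) f c →
                     Homogeneous (λ h → colour (drop (h ∘⊑ f))) g c → Homogeneous colour (keep (g ∘⊑ f)) c
  homogeneous-keep f {g} homᵏ homᵈ (keep h) = homogeneous-∘⊑ (colour ∘ keep) f (homᵏ ∘ (_∘⊑ g)) h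
  homogeneous-keep f homᵏ homᵈ (drop h) = homogeneous-∘⊑ (colour ∘ drop) f homᵈ h

  homogeneous-drop : (f : m ⊑ R) {g : l ⊑ m} →
                     Homogeneous (λ h → colour (drop (h ∘⊑ f))) g c → Homogeneous colour (drop (g ∘⊑ f)) c
  homogeneous-drop f = homogeneous-∘⊑ (colour ∘ drop) f

-- The first point is joined to a homogeneous set for the colouring it induces on the rest.
ramsey-step : ∀ k a b → Ramsey k (ramseyBound (suc k) a (suc b)) (ramseyBound (suc k) (suc a) b) →
              Ramsey (suc k) a (suc b) → Ramsey (suc k) (suc a) b → Ramsey (suc k) (suc a) (suc b)
ramsey-step k a b ramseyₖ ramseyᵃ ramseyᵇ colour with ramseyₖ (colour ∘ keep)
... | inj₁ (f , homᵏ) with ramseyᵃ (λ h → colour (drop (h ∘⊑ f)))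
...   | inj₁ (g , homᵈ) = inj₁ (keep (g ∘⊑ f) , homogeneous-keep colour f homᵏ homᵈ)
...   | inj₂ (g , homᵈ) = inj₂ (drop (g ∘⊑ f) , homogeneous-drop colour f homᵈ)
ramsey-step k a b ramseyₖ ramseyᵃ ramseyᵇ colour | inj₂ (f , homᵏ) with ramseyᵇ (λ h → colour (drop (h ∘⊑ f)))
...   | inj₁ (g , homᵈ) = inj₁ (drop (g ∘⊑ f) , homogeneous-drop colour f homᵈ)
...   | inj₂ (g , homᵈ) = inj₂ (keep (g ∘⊑ f) , homogeneous-keep colour f homᵏ homᵈ)

ramsey : ∀ k a b → Ramsey k a b
ramsey zero a b colour with colour (0⊑ _) in c≡
... | true  = inj₁ (≤⇒⊑ (ℕ.m≤m+n a b) , λ g → trans (cong colour (0⊑-unique _)) c≡)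
... | false = inj₂ (≤⇒⊑ (ℕ.m≤n+m b a) , λ g → trans (cong colour (0⊑-unique _)) c≡)
ramsey (suc k) zero    b       colour = inj₁ (done , λ ())
ramsey (suc k) (suc a) zero    colour = inj₂ (done , λ ())
ramsey (suc k) (suc a) (suc b) =
  ramsey-step k a b (ramsey k _ _) (ramsey (suc k) a (suc b)) (ramsey (suc k) (suc a) b)

ramsey-homogeneous : ∀ k a (colour : k ⊑ ramseyBound k a a → Bool) →
                     Σ (a ⊑ ramseyBound k a a) λ f → ∃ (Homogeneous colour f)
ramsey-homogeneous k a colour with ramsey k a a colour
... | inj₁ (f , hom) = f , true , hom
... | inj₂ (f , hom) = f , false , hom

iteratedRamseyBound : ℕ → ℕ → ℕ → ℕ
iteratedRamseyBound k a zero    = a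
iteratedRamseyBound k a (suc m) = ramseyBound k R R
  where R = iteratedRamseyBound k a m

ramsey-simultaneous : ∀ k a m (colour : Fin m → k ⊑ iteratedRamseyBound k a m → Bool) →
                      Σ (a ⊑ iteratedRamseyBound k a m) λ f → ∀ i → ∃ (Homogeneous (colour i) f)
ramsey-simultaneous k a zero    colour = ≤⇒⊑ ℕ.≤-refl , λ ()
ramsey-simultaneous k a (suc m) colour = g ∘⊑ f , λ where
    zero    → proj₁ (proj₂ first) , homogeneous-∘⊑ (colour zero) f (proj₂ (proj₂ first) ∘ (_∘⊑ g))
    (suc i) → proj₁ (proj₂ rest i) , homogeneous-∘⊑ (colour (suc i)) f (proj₂ (proj₂ rest i))
  where
  R : ℕ
  R = iteratedRamseyBound k a m
  first : Σ (R ⊑ ramseyBound k R R) λ f → ∃ (Homogeneous (colour zero) f)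
  first = ramsey-homogeneous k R (colour zero)
  f : R ⊑ ramseyBound k R R
  f = proj₁ first
  rest : Σ (a ⊑ R) λ g → ∀ i → ∃ (Homogeneous (λ h → colour (suc i) (h ∘⊑ f)) g)
  rest = ramsey-simultaneous k a m (λ i h → colour (suc i) (h ∘⊑ f))
  g : a ⊑ R
  g = proj₁ rest

-- ℕ's _*_ and _≤_ are opened only inside this module: the theorem uses those of ℚ.
module Density where

  open import Algebra.Properties.Semiring.Sum ℕ.+-*-semiring
    using (sum-syntax; sum-cong-≗; ∑-distrib-+; ∑-comm; *-distribˡ-sum; *-distribʳ-sum)
  open import Data.Bool.Properties using (T-≡; T-not-≡)
  open import Data.Nat.Base using (_*_; _^_; _≤_)
  open import Data.Nat.Properties using (_≤?_)
  open import Data.Nat.Tactic.RingSolver using (solve-∀)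
  open import Data.Vec.Properties using (lookup⇒[]=)
  open import Function.Bundles using (Equivalence)

  ∑-const : ∀ n c → ∑[ i < n ] c ≡ n * c
  ∑-const zero    c = refl
  ∑-const (suc n) c = cong (c +_) (∑-const n c)

  ∑-mono-≤ : ∀ n {f g : Fin n → ℕ} → (∀ i → f i ≤ g i) → ∑[ i < n ] f i ≤ ∑[ i < n ] g i
  ∑-mono-≤ zero    f≤g = z≤n
  ∑-mono-≤ (suc n) f≤g = ℕ.+-mono-≤ (f≤g zero) (∑-mono-≤ n (f≤g ∘ suc))

  ∑-↑ : ∀ m n (f : Fin (m + n) → ℕ) → ∑[ k < m + n ] f k ≡ ∑[ i < m ] f (i ↑ˡ n) + ∑[ j < n ] f (m ↑ʳ j)
  ∑-↑ zero    n f = refl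
  ∑-↑ (suc m) n f = trans (cong (f zero +_) (∑-↑ m n (f ∘ suc))) (sym (ℕ.+-assoc (f zero) _ _))

  ∑-combine : ∀ m n (f : Fin (m * n) → ℕ) → ∑[ k < m * n ] f k ≡ ∑[ i < m ] ∑[ j < n ] f (combine i j)
  ∑-combine zero    n f = refl
  ∑-combine (suc m) n f = trans (∑-↑ n (m * n) f) (cong (∑[ j < n ] f (j ↑ˡ m * n) +_) (∑-combine m n (f ∘ (n ↑ʳ_))))

  ∑-mono-< : ∀ n .{{_ : NonZero n}} {f g : Fin n → ℕ} → (∀ i → f i ℕ.< g i) → ∑[ i < n ] f i ℕ.< ∑[ i < n ] g i
  ∑-mono-< (suc n) f<g = ℕ.+-mono-<-≤ (f<g zero) (∑-mono-≤ n (ℕ.<⇒≤ ∘ f<g ∘ suc))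

  ∃-≥-average : ∀ s .{{_ : NonZero s}} t (f : Fin s → ℕ) → s * t ≤ ∑[ i < s ] f i → ∃ λ i → t ≤ f i
  ∃-≥-average s t f s*t≤∑ with any? (λ i → t ≤? f i)
  ... | yes found = found
  ... | no  none  = contradiction s*t≤∑ (ℕ.<⇒≱ (begin-strict
    ∑[ i < s ] f i  <⟨ ∑-mono-< s (λ i → ℕ.≰⇒> (none ∘ (i ,_))) ⟩
    ∑[ i < s ] t    ≡⟨ ∑-const s t ⟩
    s * t           ∎))
    where open ℕ.≤-Reasoning

  bit : Bool → ℕ
  bit true  = 1
  bit false = 0

  count : (Fin n → Bool) → ℕ
  count {n} b = ∑[ i < n ] bit (b i)

  count-cong : {b b′ : Fin n → Bool} → (∀ i → b i ≡ b′ i) → count b ≡ count b′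
  count-cong b≗b′ = sum-cong-≗ (cong bit ∘ b≗b′)

  count≤n : (b : Fin n → Bool) → count b ≤ n
  count≤n {n} b = begin
    count b         ≤⟨ ∑-mono-≤ n (bit≤1 ∘ b) ⟩
    ∑[ i < n ] 1    ≡⟨ ∑-const n 1 ⟩
    n * 1           ≡⟨ ℕ.*-identityʳ n ⟩
    n               ∎
    where
    open ℕ.≤-Reasoning
    bit≤1 : ∀ x → bit x ≤ 1
    bit≤1 true  = s≤s z≤n
    bit≤1 false = z≤n

  count+count-not : (b : Fin n → Bool) → count b + count (not ∘ b) ≡ n
  count+count-not {n} b = begin
    count b + count (not ∘ b)                 ≡⟨ ∑-distrib-+ (bit ∘ b) (bit ∘ not ∘ b) ⟨
    ∑[ i < n ] (bit (b i) + bit (not (b i)))  ≡⟨ sum-cong-≗ (bit+bit-not ∘ b) ⟩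
    ∑[ i < n ] 1                              ≡⟨ ∑-const n 1 ⟩
    n * 1                                     ≡⟨ ℕ.*-identityʳ n ⟩
    n                                         ∎
    where
    open ≡-Reasoning
    bit+bit-not : ∀ x → bit x + bit (not x) ≡ 1
    bit+bit-not true  = refl
    bit+bit-not false = refl

  ∣∣≡count : (A : Subset n) → ∣ A ∣ ≡ count (lookup A)
  ∣∣≡count []          = refl
  ∣∣≡count (true  ∷ A) = cong suc (∣∣≡count A)
  ∣∣≡count (false ∷ A) = ∣∣≡count A

  choose : (b : Fin n → Bool) → m ≤ count b → Σ (m ⊑ n) λ t → ∀ i → T (b (embed t i))
  choose {zero}          b z≤n                   = done , λ ()
  choose {suc n}         b m≤count               with b zero in b₀≡
  choose {suc n} {zero}  b _                     | true  = 0⊑ _ , λ ()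
  choose {suc n} {suc m} b (s≤s m≤count)         | true  = keep (proj₁ rest) , λ where
      zero    → subst T (sym b₀≡) _
      (suc i) → proj₂ rest i
    where
    rest : Σ (m ⊑ n) λ t → ∀ i → T (b (suc (embed t i)))
    rest = choose (b ∘ suc) m≤count
  choose {suc n} {m}     b m≤count               | false = drop (proj₁ rest) , proj₂ rest
    where
    rest : Σ (m ⊑ n) λ t → ∀ i → T (b (suc (embed t i)))
    rest = choose (b ∘ suc) m≤count

  ≤-half-of-sum : ∀ a x y → a + a ≤ x + y → a ≤ x ⊎ a ≤ y
  ≤-half-of-sum a x y a+a≤x+y with a ≤? x
  ... | yes a≤x = inj₁ a≤x
  ... | no  a≰x = inj₂ (ℕ.+-cancelˡ-≤ a _ _ (ℕ.≤-trans a+a≤x+y (ℕ.+-monoˡ-≤ y (ℕ.<⇒≤ (ℕ.≰⇒> a≰x)))))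

  pigeonhole-Bool : ∀ {L} X (colour : Fin L → Bool) → X + X ≤ L →
                    ∃ λ c → Σ (X ⊑ L) λ t → ∀ i → colour (embed t i) ≡ c
  pigeonhole-Bool X colour X+X≤L
    with ≤-half-of-sum X (count colour) (count (not ∘ colour))
           (subst (X + X ≤_) (sym (count+count-not colour)) X+X≤L)
  ... | inj₁ X≤count = true  , proj₁ chosen , Equivalence.to T-≡ ∘ proj₂ chosen
    where chosen = choose colour X≤count
  ... | inj₂ X≤count = false , proj₁ chosen , Equivalence.to T-not-≡ ∘ proj₂ chosen
    where chosen = choose (not ∘ colour) X≤count

  pigeonhole : ∀ {L} n m (rows : Fin L → Fin m → Bool) → n * 2 ^ m ≤ L →
               Σ (n ⊑ L) λ t → Σ (Fin m → Bool) λ v → ∀ i j → rows (embed t i) j ≡ v j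
  pigeonhole n zero    rows n≤L = ≤⇒⊑ (subst (_≤ _) (ℕ.*-identityʳ n) n≤L) , (λ ()) , λ i ()
  pigeonhole {L} n (suc m) rows 2X≤L = t ∘⊑ t₀ , v , same
    where
    X : ℕ
    X = n * 2 ^ m
    double : ∀ a b → a * b + a * b ≡ a * (2 * b)
    double = solve-∀
    firstBit : ∃ λ c → Σ (X ⊑ L) λ t → ∀ i → rows (embed t i) zero ≡ c
    firstBit = pigeonhole-Bool X (λ i → rows i zero) (subst (_≤ L) (sym (double n (2 ^ m))) 2X≤L)
    t₀ : X ⊑ L
    t₀ = proj₁ (proj₂ firstBit)
    rest : Σ (n ⊑ X) λ t → Σ (Fin m → Bool) λ v → ∀ i j → rows (embed t₀ (embed t i)) (suc j) ≡ v j
    rest = pigeonhole n m (λ i j → rows (embed t₀ i) (suc j)) ℕ.≤-refl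
    t : n ⊑ X
    t = proj₁ rest
    v : Fin (suc m) → Bool
    v zero    = proj₁ firstBit
    v (suc j) = proj₁ (proj₂ rest) j
    same′ : ∀ i j → rows (embed t₀ (embed t i)) j ≡ v j
    same′ i zero    = proj₂ (proj₂ firstBit) (embed t i)
    same′ i (suc j) = proj₂ (proj₂ rest) i j
    same : ∀ i j → rows (embed (t ∘⊑ t₀) i) j ≡ v j
    same i j = trans (cong (λ x → rows x j) (embed-∘⊑ t t₀ i)) (same′ i j)

  markov : ∀ q L B .{{_ : NonZero B}} (F : Fin L → ℕ) → (∀ i → F i ≤ B) → L * B ≤ q * ∑[ i < L ] F i →
           L ≤ 2 * q * count (λ i → ⌊ B ≤? 2 * q * F i ⌋)
  markov q L B F F≤B LB≤q∑F = ℕ.*-cancelʳ-≤ L (2 * q * heavy) B (ℕ.+-cancelʳ-≤ (L * B) _ _ (begin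
    L * B + L * B                                   ≤⟨ ℕ.+-mono-≤ LB≤q∑F LB≤q∑F ⟩
    q * ∑[ i < L ] F i + q * ∑[ i < L ] F i         ≡⟨ double q _ ⟩
    2 * q * ∑[ i < L ] F i                          ≡⟨ *-distribˡ-sum (2 * q) F ⟩
    ∑[ i < L ] (2 * q * F i)                        ≤⟨ ∑-mono-≤ L pointwise ⟩
    ∑[ i < L ] (bit (isHeavy i) * (2 * q * B) + B)  ≡⟨ ∑-distrib-+ (λ i → bit (isHeavy i) * (2 * q * B)) (λ _ → B) ⟩
    ∑[ i < L ] (bit (isHeavy i) * (2 * q * B)) + ∑[ i < L ] B
      ≡⟨ cong₂ _+_ (*-distribʳ-sum (2 * q * B) (bit ∘ isHeavy)) (sym (∑-const L B)) ⟨
    heavy * (2 * q * B) + L * B                     ≡⟨ cong (_+ L * B) (rearrange q B heavy) ⟩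
    2 * q * heavy * B + L * B                       ∎))
    where
    open ℕ.≤-Reasoning
    isHeavy : Fin L → Bool
    isHeavy i = ⌊ B ≤? 2 * q * F i ⌋
    heavy : ℕ
    heavy = count isHeavy
    double : ∀ a b → a * b + a * b ≡ 2 * a * b
    double = solve-∀
    rearrange : ∀ a b c → c * (2 * a * b) ≡ 2 * a * c * b
    rearrange = solve-∀
    pointwise : ∀ i → 2 * q * F i ≤ bit (isHeavy i) * (2 * q * B) + B
    pointwise i with B ≤? 2 * q * F i
    ... | yes _  = ℕ.≤-trans (ℕ.*-monoʳ-≤ (2 * q) (F≤B i)) (ℕ.≤-trans (ℕ.m≤m+n _ 0) (ℕ.m≤m+n _ B))
    ... | no  B≰ = ℕ.<⇒≤ (ℕ.≰⇒> B≰)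

  -- Markov keeps the rows of density at least 1/(2q); pigeonholing on their patterns leaves n equal ones.
  identicalDenseRows : ∀ q .{{_ : NonZero q}} n .{{_ : NonZero n}} C K .{{_ : NonZero K}}
    (rows : Fin C → Fin K → Bool) → 2 * q * (n * 2 ^ K) ≤ C → C * K ≤ q * ∑[ c < C ] count (rows c) →
    Σ (n ⊑ C) λ t → Σ (Fin K → Bool) λ v → (∀ i j → rows (embed t i) j ≡ v j) × K ≤ 2 * q * count v
  identicalDenseRows q n@(suc _) C K rows enoughRows dense = t₂ ∘⊑ t₁ , v , same , vDense
    where
    isHeavy : Fin C → Bool
    isHeavy c = ⌊ K ≤? 2 * q * count (rows c) ⌋
    manyHeavy : C ≤ 2 * q * count isHeavy
    manyHeavy = markov q C K (count ∘ rows) (count≤n ∘ rows) dense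
    heavy : Σ (n * 2 ^ K ⊑ C) λ t → ∀ i → T (isHeavy (embed t i))
    heavy = choose isHeavy (ℕ.*-cancelˡ-≤ (2 * q) {{ℕ.m*n≢0 2 q}} (ℕ.≤-trans enoughRows manyHeavy))
    t₁ : n * 2 ^ K ⊑ C
    t₁ = proj₁ heavy
    patterns : Σ (n ⊑ n * 2 ^ K) λ t → Σ (Fin K → Bool) λ v → ∀ i j → rows (embed t₁ (embed t i)) j ≡ v j
    patterns = pigeonhole n K (rows ∘ embed t₁) ℕ.≤-refl
    t₂ : n ⊑ n * 2 ^ K
    t₂ = proj₁ patterns
    v : Fin K → Bool
    v = proj₁ (proj₂ patterns)
    same : ∀ i j → rows (embed (t₂ ∘⊑ t₁) i) j ≡ v j
    same i j = trans (cong (λ x → rows x j) (embed-∘⊑ t₂ t₁ i)) (proj₂ (proj₂ patterns) i j)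
    vDense : K ≤ 2 * q * count v
    vDense = subst (λ x → K ≤ 2 * q * x) (count-cong (proj₂ (proj₂ patterns) zero))
               (toWitness (proj₂ heavy (embed t₂ zero)))

  ∃-frequent-element : ∀ q s .{{_ : NonZero s}} T (A : Fin T → Subset s) → (∀ k → s ≤ q * ∣ A k ∣) →
                     ∃ λ w → T ≤ q * count (λ k → lookup (A k) w)
  ∃-frequent-element q s T A s≤q∣A∣ = ∃-≥-average s T (λ w → q * count (λ k → lookup (A k) w)) (begin
    s * T                                             ≡⟨ ℕ.*-comm s T ⟩
    T * s                                             ≡⟨ ∑-const T s ⟨
    ∑[ k < T ] s                                      ≤⟨ ∑-mono-≤ T s≤q∣A∣ ⟩
    ∑[ k < T ] (q * ∣ A k ∣)                           ≡⟨ sum-cong-≗ (λ k → cong (q *_) (∣∣≡count (A k))) ⟩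
    ∑[ k < T ] (q * ∑[ w < s ] bit (lookup (A k) w))   ≡⟨ sum-cong-≗ (λ k → *-distribˡ-sum q (λ w → bit (lookup (A k) w))) ⟩
    ∑[ k < T ] ∑[ w < s ] (q * bit (lookup (A k) w))   ≡⟨ ∑-comm (λ k w → q * bit (lookup (A k) w)) ⟩
    ∑[ w < s ] ∑[ k < T ] (q * bit (lookup (A k) w))   ≡⟨ sum-cong-≗ (λ w → *-distribˡ-sum q (λ k → bit (lookup (A k) w))) ⟨
    ∑[ w < s ] (q * count (λ k → lookup (A k) w))      ∎)
    where open ℕ.≤-Reasoning

  -- boxD and boxE are successors, so the row lengths given to markov are nonzero.
  boxE boxD boxC : ℕ → ℕ → ℕ
  boxE q n = suc (2 * (2 * q) * n)
  boxD q n = suc (2 * (2 * q) * (n * 2 ^ boxE q n))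
  boxC q n = 2 * q * (n * 2 ^ (boxD q n * boxE q n))

  n≤boxE : ∀ q .{{_ : NonZero q}} n → n ≤ boxE q n
  n≤boxE q n = ℕ.≤-trans (ℕ.m≤n*m n (2 * (2 * q)) {{ℕ.m*n≢0 2 (2 * q) {{_}} {{ℕ.m*n≢0 2 q}}}}) (ℕ.n≤1+n _)

  commonElementInSubbox : ∀ q .{{_ : NonZero q}} n s .{{_ : NonZero s}} →
    (A : Fin (boxC q n) → Fin (boxD q n) → Fin (boxE q n) → Subset s) → (∀ c d e → s ≤ q * ∣ A c d e ∣) →
    Σ (Fin s) λ w → Σ (n ⊑ boxC q n) λ tᶜ → Σ (n ⊑ boxD q n) λ tᵈ → Σ (n ⊑ boxE q n) λ tᵉ →
      ∀ i j l → w ∈ A (embed tᶜ i) (embed tᵈ j) (embed tᵉ l)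
  commonElementInSubbox q zero      (suc _) A _     = zero , 0⊑ _ , 0⊑ _ , 0⊑ _ , λ ()
  commonElementInSubbox q n@(suc _) s       A dense = w , tᶜ , tᵈ , tᵉ , λ i j l → lookup⇒[]= w _ (inBox i j l)
    where
    C D E : ℕ
    C = boxC q n
    D = boxD q n
    E = boxE q n

    slice : Fin C → Fin (D * E) → Subset s
    slice c = uncurry (A c) ∘ remQuot E
    cell : Fin (C * (D * E)) → Subset s
    cell = uncurry slice ∘ remQuot (D * E)
    cell-combine : ∀ c d e → cell (combine c (combine d e)) ≡ A c d e
    cell-combine c d e = trans (cong (uncurry slice) (remQuot-combine c _)) (cong (uncurry (A c)) (remQuot-combine d e))

    common : ∃ λ w → C * (D * E) ≤ q * count (λ k → lookup (cell k) w)
    common = ∃-frequent-element q s (C * (D * E)) cell (λ _ → dense _ _ _)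
    w : Fin s
    w = proj₁ common

    rows₁ : Fin C → Fin (D * E) → Bool
    rows₁ c de = lookup (cell (combine c de)) w
    step₁ : Σ (n ⊑ C) λ t → Σ (Fin (D * E) → Bool) λ v → (∀ i j → rows₁ (embed t i) j ≡ v j) × D * E ≤ 2 * q * count v
    step₁ = identicalDenseRows q n C (D * E) rows₁ ℕ.≤-refl
              (subst (λ x → C * (D * E) ≤ q * x) (∑-combine C (D * E) (λ k → bit (lookup (cell k) w))) (proj₂ common))
    tᶜ : n ⊑ C
    tᶜ = proj₁ step₁
    v₁ : Fin (D * E) → Bool
    v₁ = proj₁ (proj₂ step₁)

    rows₂ : Fin D → Fin E → Bool
    rows₂ d e = v₁ (combine d e)
    step₂ : Σ (n ⊑ D) λ t → Σ (Fin E → Bool) λ v → (∀ i j → rows₂ (embed t i) j ≡ v j) × E ≤ 2 * (2 * q) * count v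
    step₂ = identicalDenseRows (2 * q) {{ℕ.m*n≢0 2 q}} n D E rows₂ (ℕ.n≤1+n _)
              (subst (λ x → D * E ≤ 2 * q * x) (∑-combine D E (bit ∘ v₁)) (proj₂ (proj₂ (proj₂ step₁))))
    tᵈ : n ⊑ D
    tᵈ = proj₁ step₂
    v₂ : Fin E → Bool
    v₂ = proj₁ (proj₂ step₂)

    step₃ : Σ (n ⊑ E) λ t → ∀ l → T (v₂ (embed t l))
    step₃ = choose v₂ (ℕ.<⇒≤ (ℕ.*-cancelˡ-< (2 * (2 * q)) n (count v₂) (proj₂ (proj₂ (proj₂ step₂)))))
    tᵉ : n ⊑ E
    tᵉ = proj₁ step₃

    inBox : ∀ i j l → lookup (A (embed tᶜ i) (embed tᵈ j) (embed tᵉ l)) w ≡ true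
    inBox i j l = begin
      lookup (A c d e) w    ≡⟨ cong (λ X → lookup X w) (cell-combine c d e) ⟨
      rows₁ c (combine d e) ≡⟨ proj₁ (proj₂ (proj₂ step₁)) i (combine d e) ⟩
      rows₂ d e             ≡⟨ proj₁ (proj₂ (proj₂ step₂)) j e ⟩
      v₂ e                  ≡⟨ Equivalence.to T-≡ (proj₂ step₃ l) ⟩
      true                  ∎
      where
      open ≡-Reasoning
      c = embed tᶜ i
      d = embed tᵈ j
      e = embed tᵉ l

open Density using (boxC; boxD; boxE; commonElementInSubbox; n≤boxE)

↑ˡ-mono-< : ∀ {m} n {i j : Fin m} → i < j → i ↑ˡ n < j ↑ˡ n
↑ˡ-mono-< n {i} {j} = subst₂ ℕ._<_ (sym (toℕ-↑ˡ i n)) (sym (toℕ-↑ˡ j n))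

↑ʳ-mono-< : ∀ m {i j : Fin n} → i < j → m ↑ʳ i < m ↑ʳ j
↑ʳ-mono-< m {i} {j} i<j = subst₂ ℕ._<_ (sym (toℕ-↑ʳ m i)) (sym (toℕ-↑ʳ m j)) (ℕ.+-monoʳ-< m i<j)

↑ˡ<↑ʳ : ∀ {m} (i : Fin m) (j : Fin n) → i ↑ˡ n < m ↑ʳ j
↑ˡ<↑ʳ {n} {m} i j = subst₂ ℕ._<_ (sym (toℕ-↑ˡ i n)) (sym (toℕ-↑ʳ m j)) (ℕ.≤-trans (toℕ<n i) (ℕ.m≤m+n m _))

frameSize : ℕ → ℕ → ℕ → ℕ
frameSize C D E = C + suc (D + suc E)

lastBlock≤frameSize : ∀ C D E → E ℕ.≤ frameSize C D E
lastBlock≤frameSize C D E =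
  ℕ.≤-trans (ℕ.n≤1+n E) (ℕ.≤-trans (ℕ.m≤n+m (suc E) D) (ℕ.≤-trans (ℕ.n≤1+n _) (ℕ.m≤n+m _ C)))

module Frame (C D E : ℕ) where

  M : ℕ
  M = frameSize C D E

  posC : Fin C → Fin M
  posC x = x ↑ˡ suc (D + suc E)

  α : Fin M
  α = C ↑ʳ zero

  posD : Fin D → Fin M
  posD y = C ↑ʳ suc (y ↑ˡ suc E)

  β : Fin M
  β = C ↑ʳ suc (D ↑ʳ zero)

  posE : Fin E → Fin M
  posE z = C ↑ʳ suc (D ↑ʳ suc z)

  posC<ʳ : ∀ x u → posC x < C ↑ʳ u
  posC<ʳ = ↑ˡ<↑ʳ

  α<ʳ : ∀ u → α < C ↑ʳ suc u
  α<ʳ u = ↑ʳ-mono-< C (s≤s z≤n)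

  posD<ʳ : ∀ y u → posD y < C ↑ʳ suc (D ↑ʳ u)
  posD<ʳ y u = ↑ʳ-mono-< C (s≤s (↑ˡ<↑ʳ y u))

  β<posE : ∀ z → β < posE z
  β<posE z = ↑ʳ-mono-< C (s≤s (↑ʳ-mono-< D (s≤s z≤n)))

  posC-mono : ∀ {x x′} → x < x′ → posC x < posC x′
  posC-mono = ↑ˡ-mono-< _

  posD-mono : ∀ {y y′} → y < y′ → posD y < posD y′
  posD-mono y<y′ = ↑ʳ-mono-< C (s≤s (↑ˡ-mono-< _ y<y′))

  posE-mono : ∀ {z z′} → z < z′ → posE z < posE z′
  posE-mono z<z′ = ↑ʳ-mono-< C (s≤s (↑ʳ-mono-< D (s≤s z<z′)))

  module Layout (a b : Fin n) (a<b : a < b) (tᶜ : n ⊑ C) (tᵈ : n ⊑ D) (tᵉ : n ⊑ E) where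

    data Region (i : Fin n) : Set where
      before  : i < a → Region i
      at-a    : i ≡ a → Region i
      between : a < i → i < b → Region i
      at-b    : i ≡ b → Region i
      after   : b < i → Region i

    region : ∀ i → Region i
    region i with <-cmp i a
    ... | tri< i<a _ _ = before i<a
    ... | tri≈ _ i≡a _ = at-a i≡a
    ... | tri> _ _ a<i with <-cmp i b
    ...   | tri< i<b _ _ = between a<i i<b
    ...   | tri≈ _ i≡b _ = at-b i≡b
    ...   | tri> _ _ b<i = after b<i

    place : ∀ {i} → Region i → Fin M
    place {i} (before _)    = posC (embed tᶜ i)
    place     (at-a _)      = α
    place {i} (between _ _) = posD (embed tᵈ i)
    place     (at-b _)      = β
    place {i} (after _)     = posE (embed tᵉ i)

    layout : Fin n → Fin M
    layout i = place (region i)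

    place-increasing : ∀ {i j} → i < j → (r : Region i) (r′ : Region j) → place r < place r′
    place-increasing i<j (before _)    (before _)    = posC-mono (embed-increasing tᶜ _ _ i<j)
    place-increasing i<j (before _)    (at-a _)      = posC<ʳ _ _
    place-increasing i<j (before _)    (between _ _) = posC<ʳ _ _
    place-increasing i<j (before _)    (at-b _)      = posC<ʳ _ _
    place-increasing i<j (before _)    (after _)     = posC<ʳ _ _
    place-increasing i<j (at-a _)      (between _ _) = α<ʳ _
    place-increasing i<j (at-a _)      (at-b _)      = α<ʳ _
    place-increasing i<j (at-a _)      (after _)     = α<ʳ _
    place-increasing i<j (between _ _) (between _ _) = posD-mono (embed-increasing tᵈ _ _ i<j)
    place-increasing i<j (between _ _) (at-b _)      = posD<ʳ _ _
    place-increasing i<j (between _ _) (after _)     = posD<ʳ _ _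
    place-increasing i<j (at-b _)      (after _)     = β<posE _
    place-increasing i<j (after _)     (after _)     = posE-mono (embed-increasing tᵉ _ _ i<j)
    place-increasing i<j (at-a refl)      (before j<a)    = ⊥-elim (<-asym i<j j<a)
    place-increasing i<j (at-a refl)      (at-a refl)     = ⊥-elim (<-irrefl refl i<j)
    place-increasing i<j (between a<i _)  (before j<a)    = ⊥-elim (<-asym (<-trans a<i i<j) j<a)
    place-increasing i<j (between a<i _)  (at-a refl)     = ⊥-elim (<-asym a<i i<j)
    place-increasing i<j (at-b refl)      (before j<a)    = ⊥-elim (<-asym a<b (<-trans i<j j<a))
    place-increasing i<j (at-b refl)      (at-a refl)     = ⊥-elim (<-asym a<b i<j)
    place-increasing i<j (at-b refl)      (between _ j<b) = ⊥-elim (<-asym i<j j<b)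
    place-increasing i<j (at-b refl)      (at-b refl)     = ⊥-elim (<-irrefl refl i<j)
    place-increasing i<j (after b<i)      (before j<a)    = ⊥-elim (<-asym a<b (<-trans (<-trans b<i i<j) j<a))
    place-increasing i<j (after b<i)      (at-a refl)     = ⊥-elim (<-asym a<b (<-trans b<i i<j))
    place-increasing i<j (after b<i)      (between _ j<b) = ⊥-elim (<-asym (<-trans b<i i<j) j<b)
    place-increasing i<j (after b<i)      (at-b refl)     = ⊥-elim (<-asym b<i i<j)

    layout-increasing : StrictlyIncreasing layout
    layout-increasing i j i<j = place-increasing i<j (region i) (region j)

    layout-before : ∀ {c} → c < a → layout c ≡ posC (embed tᶜ c)
    layout-before {c} c<a with region c
    ... | before _      = refl
    ... | at-a refl     = ⊥-elim (<-irrefl refl c<a)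
    ... | between a<c _ = ⊥-elim (<-asym a<c c<a)
    ... | at-b refl     = ⊥-elim (<-asym a<b c<a)
    ... | after b<c     = ⊥-elim (<-asym a<b (<-trans b<c c<a))

    layout-a : layout a ≡ α
    layout-a with region a
    ... | before a<a    = ⊥-elim (<-irrefl refl a<a)
    ... | at-a _        = refl
    ... | between a<a _ = ⊥-elim (<-irrefl refl a<a)
    ... | at-b a≡b      = ⊥-elim (<-irrefl a≡b a<b)
    ... | after b<a     = ⊥-elim (<-asym a<b b<a)

    layout-between : ∀ {d} → a < d → d < b → layout d ≡ posD (embed tᵈ d)
    layout-between {d} a<d d<b with region d
    ... | before d<a    = ⊥-elim (<-asym a<d d<a)
    ... | at-a refl     = ⊥-elim (<-irrefl refl a<d)
    ... | between _ _   = refl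
    ... | at-b refl     = ⊥-elim (<-irrefl refl d<b)
    ... | after b<d     = ⊥-elim (<-asym b<d d<b)

    layout-b : layout b ≡ β
    layout-b with region b
    ... | before b<a    = ⊥-elim (<-asym a<b b<a)
    ... | at-a b≡a      = ⊥-elim (<-irrefl (sym b≡a) a<b)
    ... | between _ b<b = ⊥-elim (<-irrefl refl b<b)
    ... | at-b _        = refl
    ... | after b<b     = ⊥-elim (<-irrefl refl b<b)

    layout-after : ∀ {e} → b < e → layout e ≡ posE (embed tᵉ e)
    layout-after {e} b<e with region e
    ... | before e<a    = ⊥-elim (<-asym e<a (<-trans a<b b<e))
    ... | at-a refl     = ⊥-elim (<-asym a<b b<e)
    ... | between _ e<b = ⊥-elim (<-asym e<b b<e)
    ... | at-b refl     = ⊥-elim (<-irrefl refl b<e)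
    ... | after _       = refl

boxFrameSize : ℕ → ℕ → ℕ
boxFrameSize q n = frameSize (boxC q n) (boxD q n) (boxE q n)

module _ {N : ℕ} (H : PartHyp N) (W : (j i j′ k j″ : Fin N) → Subset (size H i k)) where

  HasCommonVertex : (Fin n → Fin N) → Fin n → Fin n → Set
  HasCommonVertex {n} I a b = Σ (V H (I a) (I b)) λ w → ∀ (c d e : Fin n) →
    c < a → a < d → d < b → b < e → w ∈ W (I c) (I a) (I d) (I b) (I e)

  hasCommonVertex? : (I : Fin n → Fin N) (a b : Fin n) → Dec (HasCommonVertex I a b)
  hasCommonVertex? I a b = any? λ w → all? λ c → all? λ d → all? λ e →
    (c <? a) →-dec (a <? d) →-dec (d <? b) →-dec (b <? e) →-dec (w ∈? W (I c) (I a) (I d) (I b) (I e))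

  hasCommonVertex-intro : (I : Fin n → Fin N) {a b : Fin n} {x y : Fin N} → I a ≡ x → I b ≡ y →
    (w : V H x y) → (∀ c d e → c < a → a < d → d < b → b < e → w ∈ W (I c) x (I d) y (I e)) →
    HasCommonVertex I a b
  hasCommonVertex-intro I refl refl w w∈ = w , w∈

  ∈W-cong : ∀ {c c′ d d′ e e′ x y} {w : V H x y} → c ≡ c′ → d ≡ d′ → e ≡ e′ →
            w ∈ W c′ x d′ y e′ → w ∈ W c x d y e
  ∈W-cong refl refl refl w∈ = w∈

  module _ (q : ℕ) .{{_ : NonZero q}}
           (dense : ∀ j i j′ k j″ → j < i → i < j′ → j′ < k → k < j″ → size H i k ℕ.≤ q ℕ.* ∣ W j i j′ k j″ ∣) where

    commonVertexInFrame : ∀ {n} (a b : Fin n) → a < b → (φ : boxFrameSize q n ⊑ N) →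
                          Σ (n ⊑ boxFrameSize q n) λ g → HasCommonVertex (embed (g ∘⊑ φ)) a b
    commonVertexInFrame {n} a b a<b φ = g , hasCommonVertex-intro I (I≡ a layout-a) (I≡ b layout-b) w
        λ c d e c<a a<d d<b b<e → ∈W-cong (I≡ c (layout-before c<a)) (I≡ d (layout-between a<d d<b))
          (I≡ e (layout-after b<e)) (w∈ c d e)
      where
      open Frame (boxC q n) (boxD q n) (boxE q n)
      φ′ : Fin M → Fin N
      φ′ = embed φ
      φ′-mono : ∀ {x y} → x < y → φ′ x < φ′ y
      φ′-mono = embed-increasing φ _ _
      s : ℕ
      s = size H (φ′ α) (φ′ β)
      A : Fin (boxC q n) → Fin (boxD q n) → Fin (boxE q n) → Subset s
      A c d e = W (φ′ (posC c)) (φ′ α) (φ′ (posD d)) (φ′ β) (φ′ (posE e))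
      box : Σ (Fin s) λ w → Σ (n ⊑ boxC q n) λ tᶜ → Σ (n ⊑ boxD q n) λ tᵈ → Σ (n ⊑ boxE q n) λ tᵉ →
              ∀ i j l → w ∈ A (embed tᶜ i) (embed tᵈ j) (embed tᵉ l)
      box = commonElementInSubbox q n s {{ℕ.>-nonZero (nonempty H _ _ (φ′-mono (α<ʳ _)))}} A λ c d e →
        dense _ _ _ _ _ (φ′-mono (posC<ʳ _ _)) (φ′-mono (α<ʳ _)) (φ′-mono (posD<ʳ _ _)) (φ′-mono (β<posE _))
      w : Fin s
      w = proj₁ box
      tᶜ : n ⊑ boxC q n
      tᶜ = proj₁ (proj₂ box)
      tᵈ : n ⊑ boxD q n
      tᵈ = proj₁ (proj₂ (proj₂ box))
      tᵉ : n ⊑ boxE q n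
      tᵉ = proj₁ (proj₂ (proj₂ (proj₂ box)))
      w∈ : ∀ i j l → w ∈ A (embed tᶜ i) (embed tᵈ j) (embed tᵉ l)
      w∈ = proj₂ (proj₂ (proj₂ (proj₂ box)))
      open Layout a b a<b tᶜ tᵈ tᵉ
      fromLayout : Σ (n ⊑ M) λ g → ∀ i → embed g i ≡ layout i
      fromLayout = increasing⇒⊑ layout layout-increasing
      g : n ⊑ M
      g = proj₁ fromLayout
      I : Fin n → Fin N
      I = embed (g ∘⊑ φ)
      I≡ : ∀ i {x} → layout i ≡ x → I i ≡ φ′ x
      I≡ i layout≡x = trans (embed-∘⊑ g φ i) (cong φ′ (trans (proj₂ fromLayout i) layout≡x))

theoremBound : ℕ → ℕ → ℕ
theoremBound q n = iteratedRamseyBound n (boxFrameSize q n) (n ℕ.* n)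

commonVertices : ∀ q .{{_ : NonZero q}} n (H : PartHyp (theoremBound q n)) →
  (W : (j i j′ k j″ : Fin (theoremBound q n)) → Subset (size H i k)) →
  (∀ j i j′ k j″ → j < i → i < j′ → j′ < k → k < j″ → size H i k ℕ.≤ q ℕ.* ∣ W j i j′ k j″ ∣) →
  Σ (Fin n → Fin (theoremBound q n)) λ I → StrictlyIncreasing I ×
    Σ ((a b : Fin n) → a < b → V H (I a) (I b)) λ w →
      (∀ (c a d b e : Fin n) → c < a → (a<d : a < d) → (d<b : d < b) → b < e →
        w a b (<-trans a<d d<b) ∈ W (I c) (I a) (I d) (I b) (I e))
commonVertices q n H W dense =
  I , embed-increasing (t₀ ∘⊑ f) , (λ a b a<b → proj₁ (common a b a<b)) ,
  λ c a d b e c<a a<d d<b b<e → proj₂ (common a b (<-trans a<d d<b)) c d e c<a a<d d<b b<e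
  where
  colour : Fin (n ℕ.* n) → n ⊑ theoremBound q n → Bool
  colour ab X = ⌊ uncurry (hasCommonVertex? H W (embed X)) (remQuot n ab) ⌋
  homogeneous : Σ (boxFrameSize q n ⊑ theoremBound q n) λ f → ∀ ab → ∃ (Homogeneous (colour ab) f)
  homogeneous = ramsey-simultaneous n (boxFrameSize q n) (n ℕ.* n) colour
  f : boxFrameSize q n ⊑ theoremBound q n
  f = proj₁ homogeneous
  t₀ : n ⊑ boxFrameSize q n
  t₀ = ≤⇒⊑ (ℕ.≤-trans (n≤boxE q n) (lastBlock≤frameSize (boxC q n) (boxD q n) (boxE q n)))
  I : Fin n → Fin (theoremBound q n)
  I = embed (t₀ ∘⊑ f)
  colour-combine : ∀ a b X → colour (combine a b) X ≡ ⌊ hasCommonVertex? H W (embed X) a b ⌋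
  colour-combine a b X = cong (⌊_⌋ ∘ uncurry (hasCommonVertex? H W (embed X))) (remQuot-combine a b)
  common : ∀ a b → a < b → HasCommonVertex H W I a b
  common a b a<b = toWitness {a? = P? (t₀ ∘⊑ f)} (subst T (sym I-colour) _)
    where
    P? : (X : n ⊑ theoremBound q n) → Dec (HasCommonVertex H W (embed X) a b)
    P? X = hasCommonVertex? H W (embed X) a b
    inFrame : Σ (n ⊑ boxFrameSize q n) λ g → HasCommonVertex H W (embed (g ∘⊑ f)) a b
    inFrame = commonVertexInFrame H W q dense a b a<b f
    g : n ⊑ boxFrameSize q n
    g = proj₁ inFrame
    I-colour : ⌊ P? (t₀ ∘⊑ f) ⌋ ≡ true
    I-colour = begin
      ⌊ P? (t₀ ∘⊑ f) ⌋                ≡⟨ colour-combine a b (t₀ ∘⊑ f) ⟨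
      colour (combine a b) (t₀ ∘⊑ f)  ≡⟨ homogeneous-agree (colour (combine a b)) (proj₂ (proj₂ homogeneous (combine a b))) t₀ g ⟩
      colour (combine a b) (g ∘⊑ f)   ≡⟨ colour-combine a b (g ∘⊑ f) ⟩
      ⌊ P? (g ∘⊑ f) ⌋                 ≡⟨ isYes≗does (P? (g ∘⊑ f)) ⟩
      does (P? (g ∘⊑ f))              ≡⟨ dec-true (P? (g ∘⊑ f)) (proj₂ inFrame) ⟩
      true                            ∎
      where open ≡-Reasoning

open import Data.Integer.Base as ℤ using (+_)
import Data.Integer.Properties as ℤ
open import Data.Rational using (ℚ; mkℚ; _≤_; _*_; Positive; ↧ₙ_)
open import Data.Rational.Properties using (toℚᵘ-mono-≤; toℚᵘ-homo-*; toℚᵘ-fromℚᵘ)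
open import Data.Rational.Unnormalised.Base using (mkℚᵘ)
import Data.Rational.Unnormalised.Properties as ℚᵘ

δ*s≤m⇒s≤↧δ*m : ∀ δ → Positive δ → ∀ s m → δ * toℚ s ≤ toℚ m → s ℕ.≤ ↧ₙ δ ℕ.* m
δ*s≤m⇒s≤↧δ*m δ@(mkℚ (+ suc k) d-1 _) _ s m δs≤m =
  ℕ.≤-trans (ℕ.m≤m+n s (k ℕ.* s)) (ℤ.drop‿+≤+ (subst₂ ℤ._≤_ lhs rhs crossMultiplied))
  where
  crossMultiplied : (+ suc k ℤ.* + s) ℤ.* + 1 ℤ.≤ + m ℤ.* + (suc d-1 ℕ.* 1)
  crossMultiplied = ℚᵘ.drop-*≤* (ℚᵘ.≤-respʳ-≃ (toℚᵘ-fromℚᵘ (mkℚᵘ (+ m) 0)) (ℚᵘ.≤-respˡ-≃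
    (ℚᵘ.≃-trans (toℚᵘ-homo-* δ (toℚ s)) (ℚᵘ.*-congˡ {mkℚᵘ (+ suc k) d-1} (toℚᵘ-fromℚᵘ (mkℚᵘ (+ s) 0))))
    (toℚᵘ-mono-≤ δs≤m)))
  lhs : (+ suc k ℤ.* + s) ℤ.* + 1 ≡ + (suc k ℕ.* s)
  lhs = trans (ℤ.*-identityʳ _) (sym (ℤ.pos-* (suc k) s))
  rhs : + m ℤ.* + (suc d-1 ℕ.* 1) ≡ + (suc d-1 ℕ.* m)
  rhs = trans (sym (ℤ.pos-* m (suc d-1 ℕ.* 1))) (cong +_ (trans (cong (m ℕ.*_) (ℕ.*-identityʳ (suc d-1))) (ℕ.*-comm m (suc d-1))))

lemma8 : (δ : ℚ) → Positive δ → (n : ℕ) → Σ ℕ λ N →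
  (H : PartHyp N) →
  (W : (j i j′ k j″ : Fin N) → Subset (size H i k)) →
  (∀ j i j′ k j″ → j < i → i < j′ → j′ < k → k < j″ →
    δ * toℚ (size H i k) ≤ toℚ ∣ W j i j′ k j″ ∣) →
  Σ (Fin n → Fin N) λ I → StrictlyIncreasing I ×
    Σ ((a b : Fin n) → a < b → V H (I a) (I b)) λ w →
      (∀ (c a d b e : Fin n) → c < a → (a<d : a < d) → (d<b : d < b) → b < e →
        w a b (<-trans a<d d<b) ∈ W (I c) (I a) (I d) (I b) (I e))
lemma8 δ δ>0 n = theoremBound (↧ₙ δ) n , λ H W dense →
  commonVertices (↧ₙ δ) n H W λ j i j′ k j″ j<i i<j′ j′<k k<j″ →
    δ*s≤m⇒s≤↧δ*m δ δ>0 _ _ (dense j i j′ k j″ j<i i<j′ j′<k k<j″)
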